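{- Let $\mathbb{F}$ be a field, let $n\ge r\ge1$, $d\ge1$, $\delta\in(0,1]$ and $\gamma\in[0,1]$. Let $\mathcal{E}\subseteq\mathbb{F}^{n\times nd}$ be an $(\le\lceil(1-\gamma)rd\rceil,\delta)$-lossy rank condenser. For $i\in[d]$ let $T_i\in\mathbb{F}^{nd\times n}$ be the matrix of the linear map $v\mapsto v\otimes e_i$, where $e_i\in\mathbb{F}^d$ is the $i$-th standard basis vector. Let $\mathcal{A}:=\{ET_i: E\in\mathcal{E}, i\in[d]\}$. Then $\mathcal{A}\subseteq\mathbb{F}^{n\times n}$ is an $(r/n,(1-\gamma)(1-\delta)d)$-dimension expander of degree $d\cdot|\mathcal{E}|$.
   Context: A collection $\mathcal{E}\subseteq\mathbb{F}^{t\times m}$ is an $(s,\epsilon)$-lossy rank condenser if for every $M\in\mathbb{F}^{m\times s}$ of rank $s$ there is some $E\in\mathcal{E}$ with $\mathrm{rank}(EM)\ge(1-\epsilon)s$; it is an $(\le r,\epsilon)$-lossy rank condenser if it is an $(s,\epsilon)$-lossy rank condenser for every $1\le s\le r$. A collection $\mathcal{A}=\{A_1,\ldots,A_k\}\subseteq\mathbb{F}^{n\times n}$ is an $(\epsilon,\alpha)$-dimension expander of degree $k$ if every subspace $V\subseteq\mathbb{F}^n$ with $\dim V\le\epsilon n$ satisfies $\dim\sum_{j}A_j(V)\ge\alpha\dim V$. -}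

module Defs where

open import Level using (Level; _⊔_; suc)
open import Data.Nat as ℕ using (ℕ; zero; NonZero)
open import Data.Fin as Fin using (Fin; remQuot)
open import Data.Fin.Properties using () renaming (_≟_ to _≟ᶠ_)
open import Data.Bool using (if_then_else_; _∧_)
open import Data.Product using (Σ; ∃; _×_; _,_; proj₁; proj₂)
open import Data.Integer as ℤ using (ℤ; +_)
open import Data.Rational as ℚ using (ℚ; _/_)
open import Relation.Nullary using (¬_)
open import Relation.Nullary.Decidable using (⌊_⌋)
open import Algebra.Bundles using (CommutativeRing)

record Field (c ℓ : Level) : Set (Level.suc (c ⊔ ℓ)) where
  field
    commutativeRing : CommutativeRing c ℓ
  open CommutativeRing commutativeRing public
  field
    1≉0     : ¬ (1# ≈ 0#)
    inverse : ∀ x → ¬ (x ≈ 0#) → Σ Carrier λ y → x * y ≈ 1#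

ℕ→ℚ : ℕ → ℚ
ℕ→ℚ k = + k / 1

module _ {c ℓ : Level} (F : Field c ℓ) where
  open Field F

  Matrix : ℕ → ℕ → Set c
  Matrix m n = Fin m → Fin n → Carrier

  ∑ : (n : ℕ) → (Fin n → Carrier) → Carrier
  ∑ zero    f = 0#
  ∑ (ℕ.suc n) f = f Fin.zero + ∑ n (λ j → f (Fin.suc j))

  _⊙_ : {m k n : ℕ} → Matrix m k → Matrix k n → Matrix m n
  _⊙_ {k = k} A B i j = ∑ k (λ l → A i l * B l j)

  LinIndepCols : {m s : ℕ} → Matrix m s → Set (c ⊔ ℓ)
  LinIndepCols {m} {s} M =
    (coef : Fin s → Carrier) →
    (∀ i → ∑ s (λ j → M i j * coef j) ≈ 0#) →
    ∀ j → coef j ≈ 0#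

  RankAtLeast : {m n : ℕ} → Matrix m n → ℕ → Set (c ⊔ ℓ)
  RankAtLeast {m} {n} M k =
    Σ (Fin k → Fin n) λ σ → LinIndepCols (λ i j → M i (σ j))

  LossyRankCondenser : {t m N : ℕ} → (Fin N → Matrix t m) → ℕ → ℚ → Set (c ⊔ ℓ)
  LossyRankCondenser {t} {m} {N} ℰ s ε =
    (M : Matrix m s) → LinIndepCols M →
    Σ (Fin N) λ e → Σ ℕ λ k →
      RankAtLeast (ℰ e ⊙ M) k × ((ℚ.1ℚ ℚ.- ε) ℚ.* ℕ→ℚ s) ℚ.≤ ℕ→ℚ k

  -- (≤ r, ε)-lossy rank condenser; r is an integer (e.g. a ceiling)
  LossyRankCondenser≤ : {t m N : ℕ} → (Fin N → Matrix t m) → ℤ → ℚ → Set (c ⊔ ℓ)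
  LossyRankCondenser≤ ℰ r ε =
    (s : ℕ) → 1 ℕ.≤ s → (+ s) ℤ.≤ r → LossyRankCondenser ℰ s ε

  -- A subspace V ⊆ Fⁿ of dimension s is given by a basis, i.e. an n × s matrix M
  -- with linearly independent columns; ∑_j A_j(V) is the column span of the
  -- n × (k·s) matrix whose column (j , l) is A_j applied to the l-th basis vector.
  DimensionExpander : {n k : ℕ} → (Fin k → Matrix n n) → ℚ → ℚ → Set (c ⊔ ℓ)
  DimensionExpander {n} {k} 𝒜 ε α =
    (s : ℕ) → (M : Matrix n s) → LinIndepCols M →
    ℕ→ℚ s ℚ.≤ ε ℚ.* ℕ→ℚ n →
    Σ ℕ λ dimSum →
      RankAtLeast {n} {k ℕ.* s}
        (λ i c → let (j , l) = remQuot s c in (𝒜 j ⊙ M) i l) dimSum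
      × (α ℚ.* ℕ→ℚ s) ℚ.≤ ℕ→ℚ dimSum

  -- T_i ∈ F^{nd × n}: matrix of v ↦ v ⊗ e_i, where Fⁿ ⊗ F^d ≅ F^{nd} via
  -- (a , b) ↦ a·d + b (Data.Fin.combine / remQuot).
  T : (n d : ℕ) → Fin d → Matrix (n ℕ.* d) n
  T n d i p a =
    let (a′ , b) = remQuot d p in
    if ⌊ a′ ≟ᶠ a ⌋ ∧ ⌊ b ≟ᶠ i ⌋ then 1# else 0#

  -- 𝒜 = { E T_i : E ∈ ℰ, i ∈ [d] }, indexed by Fin (N · d) ≅ Fin N × Fin d
  condenserFamily : (n d N : ℕ) → (Fin N → Matrix n (n ℕ.* d)) → Fin (N ℕ.* d) → Matrix n n
  condenserFamily n d N ℰ x =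
    let (e , i) = remQuot d x in ℰ e ⊙ T n d i

module Submission where

open import Defs
open import Level using (Level)
open import Data.Nat as ℕ using (ℕ; NonZero; zero; suc)
open import Data.Fin using (Fin)
open import Data.Integer using (+_)
open import Data.Rational as ℚ using (ℚ; _/_; 0ℚ; 1ℚ; ceiling)

import Data.Nat.Properties as ℕP
import Data.Integer as ℤ
import Data.Rational.Properties as ℚP
open import Data.Product using (Σ; _×_; _,_)
open import Relation.Binary.PropositionalEquality as ≡ using (_≡_)

-- Let V ⊆ Fⁿ have dimension s ≤ (r/n)·n = r, with basis the columns of M.
-- The d·s columns of W = [T_1 M | … | T_d M] are independent: they span
-- V ⊗ F^d.  Put t = min(ds, ⌈(1-γ)rd⌉⁺).  If t ≥ 1, the lossy rank condenser
-- applied to t of these columns gives E ∈ ℰ with rank(E W′) ≥ (1-δ)t, and every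
-- column of E W′ is a column E T_i M e_l of the matrix spanning ∑_j A_j(V), so
-- dim ∑_j A_j(V) ≥ (1-δ)t.  Finally (1-γ)·ds ≤ t (because s ≤ r and γ ∈ [0,1]),
-- whence (1-γ)(1-δ)d·s ≤ (1-δ)t.  If t = 0 the same inequality chain with the
-- trivial rank bound 0 suffices; this covers s = 0 and the degenerate γ = 1.

module Matrices {c ℓ : Level} (F : Field c ℓ) where

  open import Data.Fin as Fin using (remQuot; combine; _↑ˡ_; _↑ʳ_; cast)
  open import Data.Fin.Properties using (remQuot-combine; combine-remQuot; cast-is-id)
    renaming (_≟_ to _≟ᶠ_)
  open import Data.Bool using (Bool; true; false; if_then_else_; _∧_)
  open import Data.Product using (proj₁; proj₂)
  open import Relation.Nullary using (yes; no)
  open import Relation.Nullary.Decidable using (⌊_⌋)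

  open Field F
  open import Algebra.Properties.Semiring.Sum semiring
    using (sum; sum-cong-≋; sum-cong-≗; sum-replicate-zero; ∑-comm; *-distribˡ-sum; *-distribʳ-sum)
  open import Relation.Binary.Reasoning.Setoid setoid

  ∑≡sum : ∀ n (f : Fin n → Carrier) → ∑ F n f ≡ sum f
  ∑≡sum zero    f = ≡.refl
  ∑≡sum (suc n) f = ≡.cong (λ x → f Fin.zero + x) (∑≡sum n (λ j → f (Fin.suc j)))

  ∑-cong : ∀ n {f g : Fin n → Carrier} → (∀ j → f j ≈ g j) → ∑ F n f ≈ ∑ F n g
  ∑-cong n {f} {g} f≈g = begin
    ∑ F n f ≡⟨ ∑≡sum n f ⟩
    sum f   ≈⟨ sum-cong-≋ f≈g ⟩
    sum g   ≡⟨ ∑≡sum n g ⟨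
    ∑ F n g ∎

  ∑-zero : ∀ n → ∑ F n (λ _ → 0#) ≈ 0#
  ∑-zero n = trans (reflexive (∑≡sum n _)) (sum-replicate-zero n)

  ∑-*ˡ : ∀ n x (f : Fin n → Carrier) → x * ∑ F n f ≈ ∑ F n (λ j → x * f j)
  ∑-*ˡ n x f = begin
    x * ∑ F n f                ≡⟨ ≡.cong (x *_) (∑≡sum n f) ⟩
    x * sum f                  ≈⟨ *-distribˡ-sum x f ⟩
    sum (λ j → x * f j)        ≡⟨ ∑≡sum n _ ⟨
    ∑ F n (λ j → x * f j)      ∎

  ∑-*ʳ : ∀ n x (f : Fin n → Carrier) → ∑ F n f * x ≈ ∑ F n (λ j → f j * x)
  ∑-*ʳ n x f = begin
    ∑ F n f * x                ≡⟨ ≡.cong (_* x) (∑≡sum n f) ⟩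
    sum f * x                  ≈⟨ *-distribʳ-sum x f ⟩
    sum (λ j → f j * x)        ≡⟨ ∑≡sum n _ ⟨
    ∑ F n (λ j → f j * x)      ∎

  ∑-swap : ∀ m n (f : Fin m → Fin n → Carrier) →
    ∑ F m (λ i → ∑ F n (f i)) ≈ ∑ F n (λ j → ∑ F m (λ i → f i j))
  ∑-swap m n f = begin
    ∑ F m (λ i → ∑ F n (f i))               ≡⟨ ∑∑≡sum m n f ⟩
    sum (λ i → sum (f i))                   ≈⟨ ∑-comm f ⟩
    sum (λ j → sum (λ i → f i j))           ≡⟨ ∑∑≡sum n m (λ j i → f i j) ⟨
    ∑ F n (λ j → ∑ F m (λ i → f i j))       ∎
    where
    ∑∑≡sum : ∀ m n (g : Fin m → Fin n → Carrier) →
      ∑ F m (λ i → ∑ F n (g i)) ≡ sum (λ i → sum (g i))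
    ∑∑≡sum m n g = ≡.trans (∑≡sum m _) (sum-cong-≗ (λ i → ∑≡sum n (g i)))

  ∑-split : ∀ a b (f : Fin (a ℕ.+ b) → Carrier) →
    ∑ F (a ℕ.+ b) f ≈ ∑ F a (λ i → f (i ↑ˡ b)) + ∑ F b (λ j → f (a ↑ʳ j))
  ∑-split zero    b f = sym (+-identityˡ _)
  ∑-split (suc a) b f = trans (+-congˡ (∑-split a b _)) (sym (+-assoc _ _ _))

  ∑-combine : ∀ m n (f : Fin (m ℕ.* n) → Carrier) →
    ∑ F (m ℕ.* n) f ≈ ∑ F m (λ i → ∑ F n (λ j → f (combine i j)))
  ∑-combine zero    n f = refl
  ∑-combine (suc m) n f = trans (∑-split n (m ℕ.* n) f) (+-congˡ (∑-combine m n _))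

  _≡ᵇ_ : ∀ {n} → Fin n → Fin n → Bool
  a ≡ᵇ b = ⌊ a ≟ᶠ b ⌋

  suc-≡ᵇ : ∀ {n} (a b : Fin n) → (Fin.suc a ≡ᵇ Fin.suc b) ≡ (a ≡ᵇ b)
  suc-≡ᵇ a b with a ≟ᶠ b
  ... | yes _ = ≡.refl
  ... | no  _ = ≡.refl

  ∑-delta : ∀ n (a : Fin n) (G : Fin n → Carrier) →
    ∑ F n (λ i → if a ≡ᵇ i then G i else 0#) ≈ G a
  ∑-delta (suc n) Fin.zero    G = trans (+-congˡ (∑-zero n)) (+-identityʳ _)
  ∑-delta (suc n) (Fin.suc a) G = begin
    0# + ∑ F n (λ i → if Fin.suc a ≡ᵇ Fin.suc i then G (Fin.suc i) else 0#)
      ≈⟨ +-identityˡ _ ⟩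
    ∑ F n (λ i → if Fin.suc a ≡ᵇ Fin.suc i then G (Fin.suc i) else 0#)
      ≈⟨ ∑-cong n (λ i → reflexive (≡.cong (λ b → if b then G (Fin.suc i) else 0#) (suc-≡ᵇ a i))) ⟩
    ∑ F n (λ i → if a ≡ᵇ i then G (Fin.suc i) else 0#)
      ≈⟨ ∑-delta n a (λ i → G (Fin.suc i)) ⟩
    G (Fin.suc a) ∎

  ⊙-assoc : ∀ {m k p n} (A : Matrix F m k) (B : Matrix F k p) (C : Matrix F p n) i j →
    _⊙_ F (_⊙_ F A B) C i j ≈ _⊙_ F A (_⊙_ F B C) i j
  ⊙-assoc {k = k} {p} A B C i j = begin
    ∑ F p (λ l → ∑ F k (λ r → A i r * B r l) * C l j)
      ≈⟨ ∑-cong p (λ l → ∑-*ʳ k (C l j) _) ⟩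
    ∑ F p (λ l → ∑ F k (λ r → A i r * B r l * C l j))
      ≈⟨ ∑-swap p k _ ⟩
    ∑ F k (λ r → ∑ F p (λ l → A i r * B r l * C l j))
      ≈⟨ ∑-cong k (λ r → ∑-cong p (λ l → *-assoc (A i r) (B r l) (C l j))) ⟩
    ∑ F k (λ r → ∑ F p (λ l → A i r * (B r l * C l j)))
      ≈⟨ ∑-cong k (λ r → sym (∑-*ˡ p (A i r) _)) ⟩
    ∑ F k (λ r → A i r * ∑ F p (λ l → B r l * C l j)) ∎

  indep-cong : ∀ {m s} {A B : Matrix F m s} → (∀ i j → A i j ≈ B i j) →
    LinIndepCols F A → LinIndepCols F B
  indep-cong {s = s} A≈B indA coef Bcoef≈0 =
    indA coef (λ i → trans (∑-cong s (λ j → *-congʳ (A≈B i j))) (Bcoef≈0 i))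

  -- Dropping the first column keeps the remaining columns independent
  -- (extend a dependency of the rest by a zero coefficient).
  indep-tail : ∀ {m s} (W : Matrix F m (suc s)) → LinIndepCols F W →
    LinIndepCols F (λ i j → W i (Fin.suc j))
  indep-tail {s = s} W indW coef rest≈0 j = indW coef₀ W·coef₀≈0 (Fin.suc j)
    where
    coef₀ : Fin (suc s) → Carrier
    coef₀ Fin.zero    = 0#
    coef₀ (Fin.suc j) = coef j
    W·coef₀≈0 : ∀ i → ∑ F (suc s) (λ j → W i j * coef₀ j) ≈ 0#
    W·coef₀≈0 i = trans (+-cong (zeroʳ _) (rest≈0 i)) (+-identityˡ 0#)

  indep-drop : ∀ k {m t} (W : Matrix F m (k ℕ.+ t)) → LinIndepCols F W →
    LinIndepCols F (λ i j → W i (k ↑ʳ j))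
  indep-drop zero    W indW = indW
  indep-drop (suc k) W indW = indep-drop k (λ i j → W i (Fin.suc j)) (indep-tail W indW)

  indep-cast : ∀ {m a b} (eq : a ≡ b) (W : Matrix F m b) → LinIndepCols F W →
    LinIndepCols F (λ i j → W i (cast eq j))
  indep-cast ≡.refl W = indep-cong (λ i j → reflexive (≡.cong (W i) (≡.sym (cast-is-id ≡.refl j))))

  rank-columns : ∀ {m a b k} (A : Matrix F m a) (B : Matrix F m b) (φ : Fin a → Fin b) →
    (∀ i j → A i j ≈ B i (φ j)) → RankAtLeast F A k → RankAtLeast F B k
  rank-columns A B φ A≈Bφ (σ , indAσ) = (λ j → φ (σ j)) , indep-cong (λ i j → A≈Bφ i (σ j)) indAσ

  rank-zero : ∀ {m b} (B : Matrix F m b) → RankAtLeast F B 0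
  rank-zero B = (λ ()) , (λ _ _ ())

  indep-select : ∀ {m′ m t} (W : Matrix F m′ m) → t ℕ.≤ m → LinIndepCols F W →
    Σ (Fin t → Fin m) λ select → LinIndepCols F (λ i j → W i (select j))
  indep-select {m = m} {t} W t≤m indW =
    (λ j → cast u+t≡m ((m ℕ.∸ t) ↑ʳ j)) ,
    indep-drop (m ℕ.∸ t) (λ i j → W i (cast u+t≡m j)) (indep-cast u+t≡m W indW)
    where
    u+t≡m : m ℕ.∸ t ℕ.+ t ≡ m
    u+t≡m = ℕP.m∸n+n≡m t≤m

  module Tensor (n d s : ℕ) (M : Matrix F n s) where

    if∧-* : ∀ x b y → (if x ∧ b then 1# else 0#) * y ≈ (if x then (if b then y else 0#) else 0#)
    if∧-* true  true  y = *-identityˡ y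
    if∧-* true  false y = zeroˡ y
    if∧-* false b     y = zeroˡ y

    T⊙M : ∀ (i i₀ : Fin d) (a : Fin n) (l : Fin s) →
      _⊙_ F (T F n d i) M (combine a i₀) l ≈ (if i₀ ≡ᵇ i then M a l else 0#)
    T⊙M i i₀ a l = begin
      ∑ F n (λ a′ → T F n d i (combine a i₀) a′ * M a′ l)
        ≡⟨ ≡.cong (λ x → ∑ F n (λ a′ → (if (proj₁ x ≡ᵇ a′) ∧ (proj₂ x ≡ᵇ i) then 1# else 0#) * M a′ l))
                  (remQuot-combine a i₀) ⟩
      ∑ F n (λ a′ → (if (a ≡ᵇ a′) ∧ (i₀ ≡ᵇ i) then 1# else 0#) * M a′ l)
        ≈⟨ ∑-cong n (λ a′ → if∧-* (a ≡ᵇ a′) (i₀ ≡ᵇ i) (M a′ l)) ⟩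
      ∑ F n (λ a′ → if a ≡ᵇ a′ then (if i₀ ≡ᵇ i then M a′ l else 0#) else 0#)
        ≈⟨ ∑-delta n a _ ⟩
      (if i₀ ≡ᵇ i then M a l else 0#) ∎

    tensorBasis : Matrix F (n ℕ.* d) (d ℕ.* s)
    tensorBasis p c = _⊙_ F (T F n d (proj₁ (remQuot {d} s c))) M p (proj₂ (remQuot {d} s c))

    tensorBasis-entry : ∀ a (i₀ i : Fin d) l →
      tensorBasis (combine a i₀) (combine i l) ≈ (if i₀ ≡ᵇ i then M a l else 0#)
    tensorBasis-entry a i₀ i l = begin
      tensorBasis (combine a i₀) (combine i l)
        ≡⟨ ≡.cong (λ x → _⊙_ F (T F n d (proj₁ x)) M (combine a i₀) (proj₂ x)) (remQuot-combine {d} {s} i l) ⟩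
      _⊙_ F (T F n d i) M (combine a i₀) l
        ≈⟨ T⊙M i i₀ a l ⟩
      (if i₀ ≡ᵇ i then M a l else 0#) ∎

    if-*ʳ : ∀ b (x y : Carrier) → (if b then x else 0#) * y ≈ (if b then x * y else 0#)
    if-*ʳ true  x y = refl
    if-*ʳ false x y = zeroˡ y

    tensorBasis-row : ∀ (coef : Fin (d ℕ.* s) → Carrier) a i₀ →
      ∑ F (d ℕ.* s) (λ c → tensorBasis (combine a i₀) c * coef c)
        ≈ ∑ F s (λ l → M a l * coef (combine i₀ l))
    tensorBasis-row coef a i₀ = begin
      ∑ F (d ℕ.* s) (λ c → tensorBasis (combine a i₀) c * coef c)
        ≈⟨ ∑-combine d s _ ⟩
      ∑ F d (λ i → ∑ F s (λ l → tensorBasis (combine a i₀) (combine i l) * coef (combine i l)))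
        ≈⟨ ∑-cong d (λ i → ∑-cong s (λ l → *-congʳ (tensorBasis-entry a i₀ i l))) ⟩
      ∑ F d (λ i → ∑ F s (λ l → (if i₀ ≡ᵇ i then M a l else 0#) * coef (combine i l)))
        ≈⟨ ∑-cong d (λ i → ∑-cong s (λ l → if-*ʳ (i₀ ≡ᵇ i) (M a l) (coef (combine i l)))) ⟩
      ∑ F d (λ i → ∑ F s (λ l → if i₀ ≡ᵇ i then M a l * coef (combine i l) else 0#))
        ≈⟨ ∑-cong d (λ i → sum-if (i₀ ≡ᵇ i) (λ l → M a l * coef (combine i l))) ⟩
      ∑ F d (λ i → if i₀ ≡ᵇ i then ∑ F s (λ l → M a l * coef (combine i l)) else 0#)
        ≈⟨ ∑-delta d i₀ _ ⟩
      ∑ F s (λ l → M a l * coef (combine i₀ l)) ∎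
      where
      sum-if : ∀ b (G : Fin s → Carrier) → ∑ F s (λ l → if b then G l else 0#) ≈ (if b then ∑ F s G else 0#)
      sum-if true  G = refl
      sum-if false G = ∑-zero s

    -- If M has independent columns then so does [T_1 M | … | T_d M]: a dependency
    -- restricted to the rows of block i₀ is a dependency among the columns of M.
    tensorBasis-indep : LinIndepCols F M → LinIndepCols F tensorBasis
    tensorBasis-indep indM coef W·coef≈0 c =
      ≡.subst (λ c′ → coef c′ ≈ 0#) (combine-remQuot {d} s c)
        (indM (λ l → coef (combine i₀ l)) (λ a → trans (sym (tensorBasis-row coef a i₀)) (W·coef≈0 _)) l₀)
      where
      i₀ : Fin d
      i₀ = proj₁ (remQuot {d} s c)
      l₀ : Fin s
      l₀ = proj₂ (remQuot {d} s c)

    spanMatrix : ∀ {k} → (Fin k → Matrix F n n) → Matrix F n (k ℕ.* s)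
    spanMatrix {k} 𝒜 i c = _⊙_ F (𝒜 (proj₁ (remQuot {k} s c))) M i (proj₂ (remQuot {k} s c))

    family-column : ∀ {N} (ℰ : Fin N → Matrix F n (n ℕ.* d)) e i l q →
      spanMatrix (condenserFamily F n d N ℰ) q (combine (combine e i) l)
        ≈ _⊙_ F (ℰ e) (_⊙_ F (T F n d i) M) q l
    family-column {N} ℰ e i l q = begin
      spanMatrix 𝒜 q (combine (combine e i) l)
        ≡⟨ ≡.cong (λ x → _⊙_ F (𝒜 (proj₁ x)) M q (proj₂ x)) (remQuot-combine {N ℕ.* d} {s} (combine e i) l) ⟩
      _⊙_ F (𝒜 (combine e i)) M q l
        ≡⟨ ≡.cong (λ x → _⊙_ F (_⊙_ F (ℰ (proj₁ x)) (T F n d (proj₂ x))) M q l) (remQuot-combine {N} {d} e i) ⟩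
      _⊙_ F (_⊙_ F (ℰ e) (T F n d i)) M q l
        ≈⟨ ⊙-assoc (ℰ e) (T F n d i) M q l ⟩
      _⊙_ F (ℰ e) (_⊙_ F (T F n d i) M) q l ∎
      where
      𝒜 : Fin (N ℕ.* d) → Matrix F n n
      𝒜 = condenserFamily F n d N ℰ

    condensed-rank : ∀ {N t k} (ℰ : Fin N → Matrix F n (n ℕ.* d)) e (select : Fin t → Fin (d ℕ.* s)) →
      RankAtLeast F (_⊙_ F (ℰ e) (λ p x → tensorBasis p (select x))) k →
      RankAtLeast F (spanMatrix (condenserFamily F n d N ℰ)) k
    condensed-rank {N} {t} ℰ e select =
      rank-columns _ (spanMatrix (condenserFamily F n d N ℰ)) (λ x → combine (combine e (block x)) (column x))
        (λ q x → sym (family-column ℰ e (block x) (column x) q))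
      where
      block : Fin t → Fin d
      block x = proj₁ (remQuot {d} s (select x))
      column : Fin t → Fin s
      column x = proj₂ (remQuot {d} s (select x))

module RationalBounds where

  open import Data.Integer as ℤ using (ℤ; -[1+_]; +≤+)
  import Data.Integer.Properties as ℤP
  import Data.Integer.DivMod as ℤD
  open import Data.Rational using (floor; mkℚ; toℚᵘ)
  import Data.Rational.Unnormalised as ℚᵘ
  import Data.Rational.Unnormalised.Properties as ℚᵘP
  open import Data.Rational.Solver using (module +-*-Solver)
  open import Data.Sum using (inj₁; inj₂)

  -- The embedding ℤ → ℚ, z ↦ z / 1; note that ℕ→ℚ k is ι (+ k) by definition.
  ι : ℤ → ℚ
  ι z = z / 1

  -- In ℚᵘ the embedding needs no normalisation; every fact about ι below is
  -- transported from this description.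
  toℚᵘ-ι : ∀ z → toℚᵘ (ι z) ℚᵘ.≃ ℚᵘ.mkℚᵘ z 0
  toℚᵘ-ι z = ℚP.toℚᵘ-fromℚᵘ (ℚᵘ.mkℚᵘ z 0)

  ι-mono : ∀ {z w} → z ℤ.≤ w → ι z ℚ.≤ ι w
  ι-mono {z} {w} z≤w = ℚP.toℚᵘ-cancel-≤
    (ℚᵘP.≤-respˡ-≃ (ℚᵘP.≃-sym (toℚᵘ-ι z)) (ℚᵘP.≤-respʳ-≃ (ℚᵘP.≃-sym (toℚᵘ-ι w))
      (ℚᵘ.*≤* (≡.subst₂ ℤ._≤_ (≡.sym (ℤP.*-identityʳ z)) (≡.sym (ℤP.*-identityʳ w)) z≤w))))

  ι-cancel : ∀ {z w} → ι z ℚ.≤ ι w → z ℤ.≤ w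
  ι-cancel {z} {w} le with ℚᵘP.≤-respˡ-≃ (toℚᵘ-ι z) (ℚᵘP.≤-respʳ-≃ (toℚᵘ-ι w) (ℚP.toℚᵘ-mono-≤ le))
  ... | ℚᵘ.*≤* z*1≤w*1 = ≡.subst₂ ℤ._≤_ (ℤP.*-identityʳ z) (ℤP.*-identityʳ w) z*1≤w*1

  ι-* : ∀ z w → ι (z ℤ.* w) ≡ ι z ℚ.* ι w
  ι-* z w = ℚP.toℚᵘ-injective (ℚᵘP.≃-trans (toℚᵘ-ι (z ℤ.* w))
    (ℚᵘP.≃-sym (ℚᵘP.≃-trans (ℚP.toℚᵘ-homo-* (ι z) (ι w)) (ℚᵘP.*-cong (toℚᵘ-ι z) (toℚᵘ-ι w)))))

  ℕ→ℚ-mono : ∀ {a b} → a ℕ.≤ b → ℕ→ℚ a ℚ.≤ ℕ→ℚ b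
  ℕ→ℚ-mono a≤b = ι-mono (+≤+ a≤b)

  ℕ→ℚ-cancel : ∀ {a b} → ℕ→ℚ a ℚ.≤ ℕ→ℚ b → a ℕ.≤ b
  ℕ→ℚ-cancel {a} {b} le with ι-cancel {+ a} {+ b} le
  ... | +≤+ a≤b = a≤b

  ℕ→ℚ-* : ∀ a b → ℕ→ℚ (a ℕ.* b) ≡ ℕ→ℚ a ℚ.* ℕ→ℚ b
  ℕ→ℚ-* a b = ≡.trans (≡.cong ι (ℤP.pos-* a b)) (ι-* (+ a) (+ b))

  ℕ→ℚ-nonNeg : ∀ a → ℚ.NonNegative (ℕ→ℚ a)
  ℕ→ℚ-nonNeg a = ℚ.nonNegative (ℕ→ℚ-mono {0} {a} ℕ.z≤n)

  -- (r / n) · n = r, so the bound dim V ≤ (r/n)·n of the theorem means dim V ≤ r.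
  /-*-cancel : ∀ r n .{{_ : NonZero n}} → (+ r / n) ℚ.* ℕ→ℚ n ≡ ℕ→ℚ r
  /-*-cancel r (suc n) = ℚP.toℚᵘ-injective (ℚᵘP.≃-trans (ℚP.toℚᵘ-homo-* (+ r / suc n) (ℕ→ℚ (suc n)))
    (ℚᵘP.≃-trans (ℚᵘP.*-cong (ℚP.toℚᵘ-fromℚᵘ (ℚᵘ.mkℚᵘ (+ r) n)) (toℚᵘ-ι (+ suc n)))
      (ℚᵘP.≃-trans (ℚᵘ.*≡* cross) (ℚᵘP.≃-sym (toℚᵘ-ι (+ r))))))
    where
    cross : (+ r ℤ.* + suc n) ℤ.* + 1 ≡ + r ℤ.* + (suc n ℕ.* 1)
    cross = ≡.trans (ℤP.*-identityʳ _) (≡.cong (λ x → + r ℤ.* + x) (≡.sym (ℕP.*-identityʳ (suc n))))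

  -- ⌊q⌋ · den q ≤ num q, read off the division identity for ↥ q / ↧ q.
  floor-≤ : ∀ q → floor q ℤ.* ℚ.↧ q ℤ.≤ ℚ.↥ q
  floor-≤ q@(mkℚ _ _ _) = ≡.subst (floor q ℤ.* ℚ.↧ q ℤ.≤_) (≡.sym (ℤD.a≡a%n+[a/n]*n (ℚ.↥ q) (ℚ.↧ q)))
    (ℤP.i≤j+i (floor q ℤ.* ℚ.↧ q) (+ (ℚ.↥ q ℤ.% ℚ.↧ q)))

  -- p ≤ ⌈p⌉, from ⌈p⌉ = -⌊-p⌋ and the floor bound for -p.
  ceiling-≥ : ∀ p → p ℚ.≤ ι (ceiling p)
  ceiling-≥ p@(mkℚ a b _) =
    ℚP.toℚᵘ-cancel-≤ (ℚᵘP.≤-respʳ-≃ (ℚᵘP.≃-sym (toℚᵘ-ι (ceiling p))) (ℚᵘ.*≤* a≤⌈p⌉·den))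
    where
    q : ℚ
    q = ℚ.- p
    a≤⌈p⌉·den : a ℤ.* + 1 ℤ.≤ ceiling p ℤ.* + suc b
    a≤⌈p⌉·den = ≡.subst₂ ℤ._≤_ lhs rhs (ℤP.neg-mono-≤ (floor-≤ q))
      where
      lhs : ℤ.- ℚ.↥ q ≡ a ℤ.* + 1
      lhs = ≡.trans (≡.cong ℤ.-_ (ℚP.↥-neg p)) (≡.trans (ℤP.neg-involutive a) (≡.sym (ℤP.*-identityʳ a)))
      rhs : ℤ.- (floor q ℤ.* ℚ.↧ q) ≡ ceiling p ℤ.* + suc b
      rhs = ≡.trans (ℤP.neg-distribˡ-* (floor q) (ℚ.↧ q)) (≡.cong (ℤ.- floor q ℤ.*_) (ℚP.↧-neg p))

  ceiling⁺ : ℚ → ℕ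
  ceiling⁺ p with ceiling p
  ... | + m      = m
  ... | -[1+ _ ] = 0

  ceiling⁺-≥ : ∀ p → p ℚ.≤ ℕ→ℚ (ceiling⁺ p)
  ceiling⁺-≥ p with ceiling p | ceiling-≥ p
  ... | + m      | p≤m  = p≤m
  ... | -[1+ m ] | p≤-m = ℚP.≤-trans p≤-m (ι-mono { -[1+ m ]} {+ 0} ℤ.-≤+)

  ≤-ceiling⁺ : ∀ p {t} → 1 ℕ.≤ t → t ℕ.≤ ceiling⁺ p → + t ℤ.≤ ceiling p
  ≤-ceiling⁺ p 1≤t t≤c with ceiling p
  ... | + m      = +≤+ t≤c
  ... | -[1+ _ ] with ℕP.≤-trans 1≤t t≤c
  ... | ()

  1-x-nonNeg : ∀ x → x ℚ.≤ 1ℚ → ℚ.NonNegative (1ℚ ℚ.- x)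
  1-x-nonNeg x x≤1 = ℚ.nonNegative
    (ℚP.≤-trans (ℚP.≤-reflexive (≡.sym (ℚP.+-inverseʳ x))) (ℚP.+-monoˡ-≤ (ℚ.- x) x≤1))

  1-x≤1 : ∀ x → 0ℚ ℚ.≤ x → 1ℚ ℚ.- x ℚ.≤ 1ℚ
  1-x≤1 x 0≤x = ℚP.+-monoʳ-≤ 1ℚ (ℚP.neg-antimono-≤ 0≤x)

  capacity : ∀ g {r d s} c → .{{ℚ.NonNegative g}} → g ℚ.≤ 1ℚ → s ℕ.≤ r →
    g ℚ.* ℕ→ℚ (r ℕ.* d) ℚ.≤ ℕ→ℚ c → g ℚ.* ℕ→ℚ (d ℕ.* s) ℚ.≤ ℕ→ℚ (d ℕ.* s ℕ.⊓ c)
  capacity g {r} {d} {s} c g≤1 s≤r g·rd≤c with ℕP.≤-total (d ℕ.* s) c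
  ... | inj₁ ds≤c = ≡.subst (λ t → g ℚ.* ℕ→ℚ (d ℕ.* s) ℚ.≤ ℕ→ℚ t) (≡.sym (ℕP.m≤n⇒m⊓n≡m ds≤c)) g·ds≤ds
    where
    g·ds≤ds : g ℚ.* ℕ→ℚ (d ℕ.* s) ℚ.≤ ℕ→ℚ (d ℕ.* s)
    g·ds≤ds = ℚP.≤-trans (ℚP.*-monoʳ-≤-nonNeg (ℕ→ℚ (d ℕ.* s)) {{ℕ→ℚ-nonNeg (d ℕ.* s)}} g≤1)
                         (ℚP.≤-reflexive (ℚP.*-identityˡ _))
  ... | inj₂ c≤ds = ≡.subst (λ t → g ℚ.* ℕ→ℚ (d ℕ.* s) ℚ.≤ ℕ→ℚ t) (≡.sym (ℕP.m≥n⇒m⊓n≡n c≤ds)) g·ds≤c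
    where
    ds≤rd : d ℕ.* s ℕ.≤ r ℕ.* d
    ds≤rd = ≡.subst (d ℕ.* s ℕ.≤_) (ℕP.*-comm d r) (ℕP.*-monoʳ-≤ d s≤r)
    g·ds≤c : g ℚ.* ℕ→ℚ (d ℕ.* s) ℚ.≤ ℕ→ℚ c
    g·ds≤c = ℚP.≤-trans (ℚP.*-monoˡ-≤-nonNeg g (ℕ→ℚ-mono ds≤rd)) g·rd≤c

  loss-chain : ∀ a b d s t k → .{{ℚ.NonNegative b}} →
    a ℚ.* ℕ→ℚ (d ℕ.* s) ℚ.≤ ℕ→ℚ t → b ℚ.* ℕ→ℚ t ℚ.≤ ℕ→ℚ k →
    ((a ℚ.* b) ℚ.* ℕ→ℚ d) ℚ.* ℕ→ℚ s ℚ.≤ ℕ→ℚ k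
  loss-chain a b d s t k a·ds≤t b·t≤k = begin
    ((a ℚ.* b) ℚ.* ℕ→ℚ d) ℚ.* ℕ→ℚ s  ≡⟨ reorder a b (ℕ→ℚ d) (ℕ→ℚ s) ⟩
    b ℚ.* (a ℚ.* (ℕ→ℚ d ℚ.* ℕ→ℚ s)) ≡⟨ ≡.cong (λ x → b ℚ.* (a ℚ.* x)) (ℕ→ℚ-* d s) ⟨
    b ℚ.* (a ℚ.* ℕ→ℚ (d ℕ.* s))     ≤⟨ ℚP.*-monoˡ-≤-nonNeg b a·ds≤t ⟩
    b ℚ.* ℕ→ℚ t                     ≤⟨ b·t≤k ⟩
    ℕ→ℚ k                           ∎
    where
    open ℚP.≤-Reasoning
    reorder : ∀ a b x y → ((a ℚ.* b) ℚ.* x) ℚ.* y ≡ b ℚ.* (a ℚ.* (x ℚ.* y))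
    reorder = +-*-Solver.solve 4 (λ a b x y → ((a :* b) :* x) :* y := b :* (a :* (x :* y))) ≡.refl
      where open +-*-Solver

open RationalBounds

proposition7p1 : {c ℓ : Level} (F : Field c ℓ) (n r d N : ℕ) .{{_ : NonZero n}}
    (δ γ : ℚ) (ℰ : Fin N → Matrix F n (n ℕ.* d)) →
    1 ℕ.≤ r → r ℕ.≤ n → 1 ℕ.≤ d →
    0ℚ ℚ.< δ → δ ℚ.≤ 1ℚ → 0ℚ ℚ.≤ γ → γ ℚ.≤ 1ℚ →
    LossyRankCondenser≤ F ℰ (ceiling ((1ℚ ℚ.- γ) ℚ.* ℕ→ℚ (r ℕ.* d))) δ →
    DimensionExpander F (condenserFamily F n d N ℰ)
      ((+ r) / n) ((1ℚ ℚ.- γ) ℚ.* (1ℚ ℚ.- δ) ℚ.* ℕ→ℚ d)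
proposition7p1 F n r d N δ γ ℰ _ _ _ _ δ≤1 0≤γ γ≤1 condenser s M indM s≤r·n/n =
  expand (d ℕ.* s ℕ.⊓ c) (ℕP.m⊓n≤m (d ℕ.* s) c)
    (capacity (1ℚ ℚ.- γ) {r} {d} {s} c (1-x≤1 γ 0≤γ) s≤r (ceiling⁺-≥ X))
    (λ 1≤t → ≤-ceiling⁺ X 1≤t (ℕP.m⊓n≤n (d ℕ.* s) c))
  where
  open Matrices F
  open Tensor n d s M
  X : ℚ
  X = (1ℚ ℚ.- γ) ℚ.* ℕ→ℚ (r ℕ.* d)
  c : ℕ
  c = ceiling⁺ X
  s≤r : s ℕ.≤ r
  s≤r = ℕ→ℚ-cancel (≡.subst (ℕ→ℚ s ℚ.≤_) (/-*-cancel r n) s≤r·n/n)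
  instance
    1-γ-nonNeg : ℚ.NonNegative (1ℚ ℚ.- γ)
    1-γ-nonNeg = 1-x-nonNeg γ γ≤1
    1-δ-nonNeg : ℚ.NonNegative (1ℚ ℚ.- δ)
    1-δ-nonNeg = 1-x-nonNeg δ δ≤1
  expand : ∀ t → t ℕ.≤ d ℕ.* s → (1ℚ ℚ.- γ) ℚ.* ℕ→ℚ (d ℕ.* s) ℚ.≤ ℕ→ℚ t →
    (1 ℕ.≤ t → + t ℤ.≤ ceiling X) →
    Σ ℕ λ dimSum → RankAtLeast F (spanMatrix (condenserFamily F n d N ℰ)) dimSum
      × ((1ℚ ℚ.- γ) ℚ.* (1ℚ ℚ.- δ) ℚ.* ℕ→ℚ d) ℚ.* ℕ→ℚ s ℚ.≤ ℕ→ℚ dimSum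
  expand zero _ cap _ =
    0 , rank-zero (spanMatrix (condenserFamily F n d N ℰ)) ,
    loss-chain (1ℚ ℚ.- γ) (1ℚ ℚ.- δ) d s 0 0 cap (ℚP.≤-reflexive (ℚP.*-zeroʳ (1ℚ ℚ.- δ)))
  expand t@(suc _) t≤ds cap t≤⌈X⌉ with indep-select tensorBasis t≤ds (tensorBasis-indep indM)
  ... | select , indW′
    with condenser t (ℕ.s≤s ℕ.z≤n) (t≤⌈X⌉ (ℕ.s≤s ℕ.z≤n)) (λ p x → tensorBasis p (select x)) indW′
  ... | e , k , rank , loss =
    k , condensed-rank ℰ e select rank , loss-chain (1ℚ ℚ.- γ) (1ℚ ℚ.- δ) d s t k cap loss
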